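{- Let $S$ be a completely simple semigroup with $n\ge 3$ minimal left ideals. Then the automorphism group of $\mathcal{I}n(S)$ is isomorphic to $S_n\times\mathbb{Z}_2$, where $S_n$ is the symmetric group of degree $n$; in particular $|\mathrm{Aut}(\mathcal{I}n(S))|=2(n!)$.
   Context: A semigroup $S$ is completely simple if it has no proper two-sided ideal and contains a primitive idempotent (an idempotent $e$ minimal among idempotents under $e\le f\iff ef=fe=e$). A left ideal is a non-empty $I\subseteq S$ with $SI\subseteq I$; it is nontrivial if $I\neq S$ and minimal if it properly contains no left ideal. The inclusion ideal graph $\mathcal{I}n(S)$ is the simple undirected graph whose vertices are the nontrivial left ideals of $S$, with distinct $I,J$ adjacent iff $I\subset J$ or $J\subset I$. A graph automorphism is a permutation of the vertex set preserving adjacency and non-adjacency. -}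

module Defs where

open import Level using (0ℓ)
open import Data.Nat.Base using (ℕ)
open import Data.Fin.Base using (Fin)
open import Data.Fin.Permutation using (Permutation′; _⟨$⟩ʳ_; _∘ₚ_)
open import Data.Bool.Base using (Bool; _xor_)
open import Data.Product.Base using (Σ; ∃; _×_; _,_; proj₁; proj₂)
open import Data.Sum.Base using (_⊎_; inj₁; inj₂)
open import Function.Base using (_∘_)
open import Relation.Nullary using (¬_)
open import Relation.Unary using (Pred; _∈_; _⊆_; _⊂_; _≐_)
open import Relation.Unary.Properties using (≐-trans)
open import Relation.Binary.PropositionalEquality using (_≡_)

-- Notions attached to a semigroup (S , _∙_)   (associativity is assumed
-- separately in the statement via IsSemigroup _≡_ _∙_).

module _ {S : Set} (_∙_ : S → S → S) where

  Subset : Set₁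
  Subset = Pred S 0ℓ

  IsLeftIdeal : Subset → Set
  IsLeftIdeal I = (∃ λ s → s ∈ I) × (∀ s t → t ∈ I → (s ∙ t) ∈ I)

  IsIdeal : Subset → Set
  IsIdeal I = (∃ λ s → s ∈ I)
            × (∀ s t → t ∈ I → (s ∙ t) ∈ I)
            × (∀ s t → t ∈ I → (t ∙ s) ∈ I)

  IsNontrivial : Subset → Set
  IsNontrivial I = ¬ (∀ s → s ∈ I)

  IsMinimalLeftIdeal : Subset → Set₁
  IsMinimalLeftIdeal L = IsLeftIdeal L × (∀ J → IsLeftIdeal J → ¬ (J ⊂ L))

  IsIdempotent : S → Set
  IsIdempotent e = e ∙ e ≡ e

  _≤E_ : S → S → Set
  e ≤E f = (e ∙ f ≡ e) × (f ∙ e ≡ e)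

  IsPrimitiveIdempotent : S → Set
  IsPrimitiveIdempotent e =
    IsIdempotent e × (∀ f → IsIdempotent f → f ≤E e → f ≡ e)

  IsCompletelySimple : Set₁
  IsCompletelySimple =
    (∀ I → IsIdeal I → ∀ s → s ∈ I) × (∃ λ e → IsPrimitiveIdempotent e)

  HasMinimalLeftIdeals : ℕ → Set₁
  HasMinimalLeftIdeals n =
    Σ (Fin n → Subset) λ L →
        (∀ i → IsMinimalLeftIdeal (L i))
      × (∀ i j → L i ≐ L j → i ≡ j)
      × (∀ M → IsMinimalLeftIdeal M → ∃ λ i → M ≐ L i)

  Vertex : Set₁
  Vertex = Σ Subset λ I → IsLeftIdeal I × IsNontrivial I

  _≈V_ : Vertex → Vertex → Set
  x ≈V y = proj₁ x ≐ proj₁ y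

  Adj : Vertex → Vertex → Set
  Adj x y = (proj₁ x ⊂ proj₁ y) ⊎ (proj₁ y ⊂ proj₁ x)

  record Automorphism : Set₁ where
    field
      to       : Vertex → Vertex
      from     : Vertex → Vertex
      to-cong   : ∀ {x y} → x ≈V y → to x ≈V to y
      from-cong : ∀ {x y} → x ≈V y → from x ≈V from y
      to-from  : ∀ x → to (from x) ≈V x
      from-to  : ∀ x → from (to x) ≈V x
      adj-to   : ∀ x y → Adj x y → Adj (to x) (to y)
      adj-from : ∀ x y → Adj (to x) (to y) → Adj x y

  open Automorphism

  _≈A_ : Automorphism → Automorphism → Set₁
  f ≈A g = ∀ x → to f x ≈V to g x

  _∘A_ : Automorphism → Automorphism → Automorphism
  f ∘A g = record
    { to        = to f ∘ to g
    ; from      = from g ∘ from f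
    ; to-cong   = to-cong f ∘ to-cong g
    ; from-cong = from-cong g ∘ from-cong f
    ; to-from   = λ x → ≐-trans (to-cong f (to-from g (from f x))) (to-from f x)
    ; from-to   = λ x → ≐-trans (from-cong g (from-to f (to g x))) (from-to g x)
    ; adj-to    = λ x y → adj-to f (to g x) (to g y) ∘ adj-to g x y
    ; adj-from  = λ x y → adj-from g x y ∘ adj-from f (to g x) (to g y)
    }

SnZ2 : ℕ → Set
SnZ2 n = Permutation′ n × Bool

_≈T_ : ∀ {n} → SnZ2 n → SnZ2 n → Set
(π , b) ≈T (ρ , c) = (∀ i → π ⟨$⟩ʳ i ≡ ρ ⟨$⟩ʳ i) × (b ≡ c)

-- product; (π , b) · (ρ , c) acts as "ρ first, then π", matching _∘A_
_·T_ : ∀ {n} → SnZ2 n → SnZ2 n → SnZ2 n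
(π , b) ·T (ρ , c) = (ρ ∘ₚ π , b xor c)

module _ {S : Set} (_∙_ : S → S → S) {n : ℕ} where

  IsGroupIsoAut : (Automorphism _∙_ → SnZ2 n) → Set₁
  IsGroupIsoAut φ =
      (∀ f g → _≈A_ _∙_ f g → φ f ≈T φ g)
    × (∀ f g → φ (_∘A_ _∙_ f g) ≈T (φ f ·T φ g))
    × (∀ f g → φ f ≈T φ g → _≈A_ _∙_ f g)
    × (∀ t → ∃ λ f → φ f ≈T t)

-- In a completely simple semigroup the minimal left ideals L₁, …, Lₙ partition S (their
-- union is a two-sided ideal), so every left ideal is the union of the Lᵢ it meets and
-- In(S) is the comparability graph of proper inclusion on the nonempty proper subsets of
-- {1, …, n}. Singletons and their complements are exactly the vertices x admitting a vertex
-- D equal or adjacent to every non-neighbour of x, so an automorphism permutes them; by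
-- non-adjacency it sends either all singletons to singletons or all to complements.
-- Composing with complementation if necessary, it then relabels the Lᵢ by a permutation σ,
-- because x contains Lᵢ iff {i} equals or is adjacent to x. Conversely each relabelling,
-- with or without complementation, is an automorphism, and for n ≥ 3 the pair (σ, b) is
-- determined by the automorphism; this is the isomorphism Aut(In(S)) ≅ Sₙ × Z₂.

module Submission where

open import Defs
open import Level using (0ℓ)
open import Algebra.Definitions using (Associative)
open import Algebra.Structures using (IsSemigroup)
open import Axiom.ExcludedMiddle using (ExcludedMiddle)
open import Axiom.DoubleNegationElimination using (DoubleNegationElimination; em⇒dne)
open import Data.Bool.Base using (Bool; true; false; _xor_)
open import Data.Empty using (⊥; ⊥-elim)
open import Data.Fin.Base using (Fin; zero; suc)
open import Data.Fin.Properties using (_≟_; ¬∀⟶∃¬)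
open import Data.Fin.Permutation
  using (Permutation′; _⟨$⟩ʳ_; _⟨$⟩ˡ_; inverseˡ; inverseʳ; flip; permutation; _∘ₚ_)
  renaming (id to idₚ)
open import Data.Nat.Base as ℕ using (ℕ; _≤_; s≤s; z≤n)
open import Data.Product.Base using (Σ; ∃; _×_; _,_; proj₁; proj₂)
open import Data.Sum.Base using (_⊎_; inj₁; inj₂; [_,_]′; swap) renaming (map to ⊎-map)
open import Data.Sum.Function.Propositional using (_⊎-cong_)
open import Function.Base using (_∘_; id)
open import Function.Bundles using (_⇔_; mk⇔; module Equivalence)
open import Function.Construct.Identity using (⇔-id)
open import Function.Construct.Symmetry using (⇔-sym)
open import Function.Construct.Composition using (_⇔-∘_)
open import Function.Related.Propositional using (module EquationalReasoning; equivalence)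
open import Relation.Nullary using (¬_; yes; no)
open import Relation.Unary using (_∈_; _⊆_; _⊂_; _≐_; _∩_)
open import Relation.Unary.Properties using (≐-refl; ≐-sym; ≐-trans)
open import Relation.Binary.PropositionalEquality
  using (_≡_; _≢_; refl; sym; trans; cong; subst; module ≡-Reasoning)

module ⇔ = Equivalence

third : ∀ {m} (a b : Fin (ℕ.suc (ℕ.suc (ℕ.suc m)))) → ∃ λ d → d ≢ a × d ≢ b
third zero          zero          = suc zero , (λ ()) , (λ ())
third zero          (suc zero)    = suc (suc zero) , (λ ()) , (λ ())
third zero          (suc (suc b)) = suc zero , (λ ()) , (λ ())
third (suc zero)    zero          = suc (suc zero) , (λ ()) , (λ ())
third (suc zero)    (suc b)       = zero , (λ ()) , (λ ())
third (suc (suc a)) zero          = suc zero , (λ ()) , (λ ())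
third (suc (suc a)) (suc b)       = zero , (λ ()) , (λ ())

negateIf : Bool → Set → Set
negateIf false A = A
negateIf true  A = ¬ A

negateIf-cong : ∀ b {A B} → A ⇔ B → negateIf b A ⇔ negateIf b B
negateIf-cong false A⇔B = A⇔B
negateIf-cong true  A⇔B = mk⇔ (λ ¬A → ¬A ∘ ⇔.from A⇔B) (λ ¬B → ¬B ∘ ⇔.to A⇔B)

negateIf-involutive : DoubleNegationElimination 0ℓ → ∀ b {A} → negateIf b (negateIf b A) ⇔ A
negateIf-involutive dne false = ⇔-id _
negateIf-involutive dne true  = mk⇔ dne (λ a ¬a → ¬a a)

negateIf-xor : DoubleNegationElimination 0ℓ → ∀ b c {A} →
               negateIf b (negateIf c A) ⇔ negateIf (b xor c) A
negateIf-xor dne false c     = ⇔-id _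
negateIf-xor dne true  false = ⇔-id _
negateIf-xor dne true  true  = negateIf-involutive dne true

module MinimalLeftIdeals (dne : DoubleNegationElimination 0ℓ) {S : Set} (_∙_ : S → S → S) where

  minimal-⊆ : ∀ {M J} → IsMinimalLeftIdeal _∙_ M → IsLeftIdeal _∙_ J → J ⊆ M → M ⊆ J
  minimal-⊆ {J = J} (_ , noSmaller) isJ J⊆M = dne (λ M⊈J → noSmaller J isJ (J⊆M , M⊈J))

  minimal-⊆-meeting : ∀ {M I s} → IsMinimalLeftIdeal _∙_ M → IsLeftIdeal _∙_ I →
                      s ∈ I → s ∈ M → M ⊆ I
  minimal-⊆-meeting {M} {I} {s} minM@((_ , closedM) , _) (_ , closedI) s∈I s∈M =
    proj₁ ∘ minimal-⊆ minM isI∩M proj₂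
    where
      isI∩M : IsLeftIdeal _∙_ (I ∩ M)
      isI∩M = (s , s∈I , s∈M) , λ a b (b∈I , b∈M) → closedI a b b∈I , closedM a b b∈M

  minimal-meeting⇒≐ : ∀ {M N s} → IsMinimalLeftIdeal _∙_ M → IsMinimalLeftIdeal _∙_ N →
                      s ∈ M → s ∈ N → M ≐ N
  minimal-meeting⇒≐ minM minN s∈M s∈N =
    minimal-⊆-meeting minM (proj₁ minN) s∈N s∈M , minimal-⊆-meeting minN (proj₁ minM) s∈M s∈N

  _∙ʳ_ : Subset _∙_ → S → Subset _∙_
  (M ∙ʳ t) u = ∃ λ v → v ∈ M × u ≡ v ∙ t

  minimal-∙ʳ : ∀ {M} → Associative _≡_ _∙_ → IsMinimalLeftIdeal _∙_ M →
               ∀ t → IsMinimalLeftIdeal _∙_ (M ∙ʳ t)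
  minimal-∙ʳ {M} assoc minM@(((s , s∈M) , closedM) , _) t = isMt , noSmaller
    where
      isMt : IsLeftIdeal _∙_ (M ∙ʳ t)
      isMt = (s ∙ t , s , s∈M , refl) ,
             λ { a _ (v , v∈M , refl) → a ∙ v , closedM a v v∈M , sym (assoc a v t) }

      noSmaller : ∀ J → IsLeftIdeal _∙_ J → ¬ (J ⊂ M ∙ʳ t)
      noSmaller J ((j , j∈J) , closedJ) (J⊆Mt , Mt⊈J) = Mt⊈J Mt⊆J
        where
          preimage : Subset _∙_
          preimage v = v ∈ M × v ∙ t ∈ J

          isPreimage : IsLeftIdeal _∙_ preimage
          isPreimage =
            (let (v , v∈M , j≡vt) = J⊆Mt j∈J in v , v∈M , subst (_∈ J) j≡vt j∈J) ,
            λ a b (b∈M , bt∈J) → closedM a b b∈M , subst (_∈ J) (sym (assoc a b t)) (closedJ a _ bt∈J)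

          Mt⊆J : M ∙ʳ t ⊆ J
          Mt⊆J (v , v∈M , refl) = proj₂ (minimal-⊆ minM isPreimage proj₁ v∈M)

module UnionsOfMinimalLeftIdeals (em : ExcludedMiddle 0ℓ) {S : Set} (_∙_ : S → S → S)
  (assoc : Associative _≡_ _∙_) (simple : ∀ I → IsIdeal _∙_ I → ∀ s → s ∈ I)
  {k : ℕ} (minimalLeftIdeals : HasMinimalLeftIdeals _∙_ (ℕ.suc k)) where

  dne : DoubleNegationElimination 0ℓ
  dne = em⇒dne em

  open MinimalLeftIdeals dne _∙_

  n : ℕ
  n = ℕ.suc k

  L : Fin n → Subset _∙_
  L = proj₁ minimalLeftIdeals

  L-minimal : ∀ i → IsMinimalLeftIdeal _∙_ (L i)
  L-minimal = proj₁ (proj₂ minimalLeftIdeals)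

  L-injective : ∀ i j → L i ≐ L j → i ≡ j
  L-injective = proj₁ (proj₂ (proj₂ minimalLeftIdeals))

  L-complete : ∀ M → IsMinimalLeftIdeal _∙_ M → ∃ λ i → M ≐ L i
  L-complete = proj₂ (proj₂ (proj₂ minimalLeftIdeals))

  L-nonempty : ∀ i → ∃ (_∈ L i)
  L-nonempty i = proj₁ (proj₁ (L-minimal i))

  L-closed : ∀ i s {t} → t ∈ L i → s ∙ t ∈ L i
  L-closed i s = proj₂ (proj₁ (L-minimal i)) s _

  L-disjoint : ∀ {i j s} → s ∈ L i → s ∈ L j → i ≡ j
  L-disjoint s∈Li s∈Lj = L-injective _ _ (minimal-meeting⇒≐ (L-minimal _) (L-minimal _) s∈Li s∈Lj)

  ⋃L : Subset _∙_
  ⋃L s = ∃ λ i → s ∈ L i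

  -- ⋃L is closed under right multiplication because L i ∙ʳ s is again minimal.
  ⋃L-isIdeal : IsIdeal _∙_ ⋃L
  ⋃L-isIdeal =
    (let (s , s∈L₀) = L-nonempty zero in s , zero , s∈L₀) ,
    (λ s t (i , t∈Li) → i , L-closed i s t∈Li) ,
    λ s t (i , t∈Li) → let (j , Lis≐Lj) = L-complete _ (minimal-∙ʳ assoc (L-minimal i) s)
                       in j , proj₁ Lis≐Lj (t , t∈Li , refl)

  L-covers : ∀ s → ∃ λ i → s ∈ L i
  L-covers = simple ⋃L ⋃L-isIdeal

  V : Set₁
  V = Vertex _∙_

  infix 4 _∋_ _⊑_ _⊏_ _≈_

  -- _∋_ and _≈_ are records so that the vertices can be inferred from their types.
  record _∋_ (x : V) (i : Fin n) : Set where
    constructor contains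
    field L⊆ : L i ⊆ proj₁ x
  open _∋_ public

  ∋-intro : ∀ {x i s} → s ∈ proj₁ x → s ∈ L i → x ∋ i
  ∋-intro {x} s∈x s∈Li = contains (minimal-⊆-meeting (L-minimal _) (proj₁ (proj₂ x)) s∈x s∈Li)

  _⊑_ : V → V → Set
  x ⊑ y = ∀ i → x ∋ i → y ∋ i

  ⊑-trans : ∀ {x y z} → x ⊑ y → y ⊑ z → x ⊑ z
  ⊑-trans x⊑y y⊑z i = y⊑z i ∘ x⊑y i

  ⊑⇒⊆ : ∀ {x y} → x ⊑ y → proj₁ x ⊆ proj₁ y
  ⊑⇒⊆ {x} x⊑y {s} s∈x = let (i , s∈Li) = L-covers s in L⊆ (x⊑y i (∋-intro {x} s∈x s∈Li)) s∈Li

  ⊆⇒⊑ : ∀ {x y} → proj₁ x ⊆ proj₁ y → x ⊑ y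
  ⊆⇒⊑ x⊆y i (contains Li⊆x) = contains (x⊆y ∘ Li⊆x)

  ∃∋ : ∀ x → ∃ (x ∋_)
  ∃∋ x@(_ , ((s , s∈x) , _) , _) = let (i , s∈Li) = L-covers s in i , ∋-intro {x} s∈x s∈Li

  ∃∌ : ∀ x → ∃ λ i → ¬ x ∋ i
  ∃∌ x@(_ , _ , nontrivial) =
    ¬∀⟶∃¬ n (x ∋_) (λ _ → em) λ ∀∋ → nontrivial λ s → let (i , s∈Li) = L-covers s in L⊆ (∀∋ i) s∈Li

  record _≈_ (x y : V) : Set where
    constructor mk≈
    field ≈⇒≐ : proj₁ x ≐ proj₁ y
  open _≈_ public

  ≈-refl : ∀ {x} → x ≈ x
  ≈-refl = mk≈ ≐-refl

  ≈-sym : ∀ {x y} → x ≈ y → y ≈ x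
  ≈-sym (mk≈ x≐y) = mk≈ (≐-sym x≐y)

  ≈-trans : ∀ {x y z} → x ≈ y → y ≈ z → x ≈ z
  ≈-trans (mk≈ x≐y) (mk≈ y≐z) = mk≈ (≐-trans x≐y y≐z)

  ≈⇒⊑ : ∀ {x y} → x ≈ y → x ⊑ y
  ≈⇒⊑ {x} {y} x≈y = ⊆⇒⊑ {x} {y} (proj₁ (≈⇒≐ x≈y))

  ⊑-antisym : ∀ {x y} → x ⊑ y → y ⊑ x → x ≈ y
  ⊑-antisym {x} {y} x⊑y y⊑x = mk≈ (⊑⇒⊆ {x} {y} x⊑y , ⊑⇒⊆ {y} {x} y⊑x)

  ∋-resp-≈ : ∀ {x y i} → x ≈ y → x ∋ i → y ∋ i
  ∋-resp-≈ x≈y = ≈⇒⊑ x≈y _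

  ∋-ext : ∀ {x y} → (∀ i → x ∋ i ⇔ y ∋ i) → x ≈ y
  ∋-ext x∼y = ⊑-antisym (λ i → ⇔.to (x∼y i)) (λ i → ⇔.from (x∼y i))

  _⊏_ : V → V → Set
  x ⊏ y = x ⊑ y × ¬ y ⊑ x

  Adj⇔⊏⊎⊐ : ∀ {x y} → Adj _∙_ x y ⇔ (x ⊏ y ⊎ y ⊏ x)
  Adj⇔⊏⊎⊐ = mk⇔ (⊎-map ⊂⇒⊏ ⊂⇒⊏) (⊎-map ⊏⇒⊂ ⊏⇒⊂)
    where
      ⊂⇒⊏ : ∀ {x y} → proj₁ x ⊂ proj₁ y → x ⊏ y
      ⊂⇒⊏ {x} {y} (x⊆y , y⊈x) = ⊆⇒⊑ {x} {y} x⊆y , y⊈x ∘ ⊑⇒⊆ {y} {x}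
      ⊏⇒⊂ : ∀ {x y} → x ⊏ y → proj₁ x ⊂ proj₁ y
      ⊏⇒⊂ {x} {y} (x⊑y , y⋢x) = ⊑⇒⊆ {x} {y} x⊑y , y⋢x ∘ ⊆⇒⊑ {y} {x}

  ⊏-resp-≈ : ∀ {x x' y y'} → x ≈ x' → y ≈ y' → x ⊏ y → x' ⊏ y'
  ⊏-resp-≈ x≈x' y≈y' (x⊑y , y⋢x) =
    ⊑-trans (≈⇒⊑ (≈-sym x≈x')) (⊑-trans x⊑y (≈⇒⊑ y≈y')) ,
    λ y'⊑x' → y⋢x (⊑-trans (≈⇒⊑ y≈y') (⊑-trans y'⊑x' (≈⇒⊑ (≈-sym x≈x'))))

  Adj-resp-≈ : ∀ {x x' y y'} → x ≈ x' → y ≈ y' → Adj _∙_ x y → Adj _∙_ x' y'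
  Adj-resp-≈ x≈x' y≈y' =
    ⇔.from Adj⇔⊏⊎⊐ ∘ ⊎-map (⊏-resp-≈ x≈x' y≈y') (⊏-resp-≈ y≈y' x≈x') ∘ ⇔.to Adj⇔⊏⊎⊐

  union : (A : Fin n → Set) → ∃ A → ∃ (λ i → ¬ A i) → V
  union A (a , Aa) (b , ¬Ab) = ⋃A , isLeftIdeal , nontrivial
    where
      ⋃A : Subset _∙_
      ⋃A s = ∃ λ i → A i × s ∈ L i

      isLeftIdeal : IsLeftIdeal _∙_ ⋃A
      isLeftIdeal = (let (s , s∈La) = L-nonempty a in s , a , Aa , s∈La) ,
                    λ s t (i , Ai , t∈Li) → i , Ai , L-closed i s t∈Li

      nontrivial : IsNontrivial _∙_ ⋃A
      nontrivial ∀∈ = let (s , s∈Lb) = L-nonempty b ; (i , Ai , s∈Li) = ∀∈ s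
                      in ¬Ab (subst A (L-disjoint s∈Li s∈Lb) Ai)

  ∋-union : ∀ {A i} (p : ∃ A) (q : ∃ λ i → ¬ A i) → union A p q ∋ i ⇔ A i
  ∋-union {A} {i} _ _ = mk⇔
    (λ (contains Li⊆⋃A) → let (s , s∈Li) = L-nonempty i ; (j , Aj , s∈Lj) = Li⊆⋃A s∈Li
                          in subst A (L-disjoint s∈Lj s∈Li) Aj)
    (λ Ai → contains λ s∈Li → i , Ai , s∈Li)

module InclusionIdealGraph (em : ExcludedMiddle 0ℓ) {S : Set} (_∙_ : S → S → S)
  (assoc : Associative _≡_ _∙_) (simple : ∀ I → IsIdeal _∙_ I → ∀ s → s ∈ I)
  {m : ℕ} (minimalLeftIdeals : HasMinimalLeftIdeals _∙_ (ℕ.suc (ℕ.suc (ℕ.suc m)))) where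

  open UnionsOfMinimalLeftIdeals em _∙_ assoc simple minimalLeftIdeals

  Adj′ : V → V → Set
  Adj′ = Adj _∙_

  fresh : (a : Fin n) → ∃ λ d → d ≢ a
  fresh a = let (d , d≢a , _) = third a a in d , d≢a

  outsidePair : (a b : Fin n) → ∃ λ d → ¬ (d ≡ a ⊎ d ≡ b)
  outsidePair a b = let (d , d≢a , d≢b) = third a b in d , [ d≢a , d≢b ]′

  self : (a : Fin n) → ∃ λ i → ¬ i ≢ a
  self a = a , λ a≢a → a≢a refl

  singleton cosingleton : Fin n → V
  singleton a   = union (_≡ a) (a , refl) (fresh a)
  cosingleton a = union (_≢ a) (fresh a) (self a)

  pair : Fin n → Fin n → V
  pair a b = union (λ i → i ≡ a ⊎ i ≡ b) (a , inj₁ refl) (outsidePair a b)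

  ∋-singleton : ∀ {a i} → singleton a ∋ i ⇔ i ≡ a
  ∋-singleton {a} = ∋-union (a , refl) (fresh a)

  ∋-cosingleton : ∀ {a i} → cosingleton a ∋ i ⇔ i ≢ a
  ∋-cosingleton {a} = ∋-union (fresh a) (self a)

  ∋-pair : ∀ {a b i} → pair a b ∋ i ⇔ (i ≡ a ⊎ i ≡ b)
  ∋-pair {a} {b} = ∋-union (a , inj₁ refl) (outsidePair a b)

  singleton-injective : ∀ {a b} → singleton a ≈ singleton b → a ≡ b
  singleton-injective sa≈sb = ⇔.to ∋-singleton (∋-resp-≈ sa≈sb (⇔.from ∋-singleton refl))

  ∋∌⇒≉ : ∀ {x y i} → x ∋ i → ¬ y ∋ i → ¬ x ≈ y
  ∋∌⇒≉ x∋i y∌i x≈y = y∌i (∋-resp-≈ x≈y x∋i)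

  ∋∌⇒≢ : ∀ {x i j} → x ∋ i → ¬ x ∋ j → i ≢ j
  ∋∌⇒≢ x∋i x∌j refl = x∌j x∋i

  incomparable⇒¬Adj : ∀ {x y i j} → x ∋ i → ¬ y ∋ i → y ∋ j → ¬ x ∋ j → ¬ Adj′ x y
  incomparable⇒¬Adj x∋i y∌i y∋j x∌j =
    [ (λ (x⊑y , _) → y∌i (x⊑y _ x∋i)) , (λ (y⊑x , _) → x∌j (y⊑x _ y∋j)) ]′ ∘ ⇔.to Adj⇔⊏⊎⊐

  ⊑⇒≈⊎Adj : ∀ {x y} → x ⊑ y → x ≈ y ⊎ Adj′ x y
  ⊑⇒≈⊎Adj {x} {y} x⊑y with em {x ≈ y}
  ... | yes x≈y = inj₁ x≈y
  ... | no  x≉y = inj₂ (⇔.from Adj⇔⊏⊎⊐ (inj₁ (x⊑y , x≉y ∘ ⊑-antisym x⊑y)))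

  Comparable : V → V → Set
  Comparable x y = x ⊑ y ⊎ y ⊑ x

  ≈⊎Adj⇒Comparable : ∀ {x y} → x ≈ y ⊎ Adj′ x y → Comparable x y
  ≈⊎Adj⇒Comparable (inj₁ x≈y) = inj₁ (≈⇒⊑ x≈y)
  ≈⊎Adj⇒Comparable (inj₂ adj) = ⊎-map proj₁ proj₁ (⇔.to Adj⇔⊏⊎⊐ adj)

  ∋⇒singleton⊑ : ∀ {x a} → x ∋ a → singleton a ⊑ x
  ∋⇒singleton⊑ {x} x∋a i sa∋i = subst (x ∋_) (sym (⇔.to ∋-singleton sa∋i)) x∋a

  -- Nonemptiness of x is what excludes x ⊏ singleton a.
  Comparable-singleton⇒∋ : ∀ {x a} → Comparable x (singleton a) → x ∋ a
  Comparable-singleton⇒∋ {x} (inj₁ x⊑sa) =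
    let (i , x∋i) = ∃∋ x in subst (x ∋_) (⇔.to ∋-singleton (x⊑sa i x∋i)) x∋i
  Comparable-singleton⇒∋ (inj₂ sa⊑x) = sa⊑x _ (⇔.from ∋-singleton refl)

  Comparable-cosingleton⇒∌ : ∀ {x a} → Comparable x (cosingleton a) → ¬ x ∋ a
  Comparable-cosingleton⇒∌ (inj₁ x⊑ca) x∋a = ⇔.to ∋-cosingleton (x⊑ca _ x∋a) refl
  Comparable-cosingleton⇒∌ {x} {a} (inj₂ ca⊑x) x∋a with ∃∌ x
  ... | i , x∌i with i ≟ a
  ...   | yes refl = x∌i x∋a
  ...   | no  i≢a  = x∌i (ca⊑x i (⇔.from ∋-cosingleton i≢a))

  ∋⇔singleton-≈⊎Adj : ∀ {x i} → x ∋ i ⇔ (singleton i ≈ x ⊎ Adj′ (singleton i) x)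
  ∋⇔singleton-≈⊎Adj =
    mk⇔ (⊑⇒≈⊎Adj ∘ ∋⇒singleton⊑) (Comparable-singleton⇒∋ ∘ swap ∘ ≈⊎Adj⇒Comparable)

  ≉singleton⇒∃∋ : ∀ {x a} → x ∋ a → ¬ x ≈ singleton a → ∃ λ a' → x ∋ a' × a' ≢ a
  ≉singleton⇒∃∋ x∋a x≉sa = dne λ ∄ → x≉sa (⊑-antisym
    (λ i x∋i → ⇔.from ∋-singleton (dne λ i≢a → ∄ (i , x∋i , i≢a)))
    (∋⇒singleton⊑ x∋a))

  ≉cosingleton⇒∃∌ : ∀ {x b} → ¬ x ∋ b → ¬ x ≈ cosingleton b → ∃ λ b' → ¬ x ∋ b' × b' ≢ b
  ≉cosingleton⇒∃∌ x∌b x≉cb = dne λ ∄ → x≉cb (⊑-antisym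
    (λ i x∋i → ⇔.from ∋-cosingleton λ { refl → x∌b x∋i })
    (λ i cb∋i → dne λ x∌i → ∄ (i , x∌i , ⇔.to ∋-cosingleton cb∋i)))

  DominatesNonNeighbours : V → V → Set₁
  DominatesNonNeighbours D x = ∀ E → ¬ E ≈ x → ¬ Adj′ x E → E ≈ D ⊎ Adj′ D E

  cosingleton-dominates : ∀ a → DominatesNonNeighbours (cosingleton a) (singleton a)
  cosingleton-dominates a E E≉sa ¬adj = ⊎-map id swap (⊑⇒≈⊎Adj E⊑ca)
    where
      E∌a : ¬ E ∋ a
      E∌a E∋a = [ E≉sa ∘ ≈-sym , ¬adj ]′ (⊑⇒≈⊎Adj (∋⇒singleton⊑ E∋a))
      E⊑ca : E ⊑ cosingleton a
      E⊑ca i E∋i = ⇔.from ∋-cosingleton λ { refl → E∌a E∋i }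

  dominated-comparable : ∀ {D x} → DominatesNonNeighbours D x →
    ∀ E {i j} → E ∋ i → ¬ x ∋ i → x ∋ j → ¬ E ∋ j → Comparable D E
  dominated-comparable dom E E∋i x∌i x∋j E∌j =
    [ inj₂ ∘ ≈⇒⊑ , ≈⊎Adj⇒Comparable ∘ inj₂ ]′ (dom E (∋∌⇒≉ E∋i x∌i) (incomparable⇒¬Adj x∋j E∌j E∋i x∌i))

  -- The vertices {b'}, ∁{a} and {a,b} are non-neighbours of x, which forces b' ∈ D and
  -- a ∉ D; then {a,b} is comparable with D in neither direction.
  ¬dominates-two-in-two-out : ∀ {D x a a' b b'} → DominatesNonNeighbours D x →
    x ∋ a → x ∋ a' → a' ≢ a → ¬ x ∋ b → ¬ x ∋ b' → b' ≢ b → ⊥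
  ¬dominates-two-in-two-out {D} {x} {a} {a'} {b} {b'} dom x∋a x∋a' a'≢a x∌b x∌b' b'≢b =
    [ (λ D⊑ab → b'∉ab (⇔.to ∋-pair (D⊑ab _ D∋b')))
    , (λ ab⊑D → D∌a (ab⊑D _ (⇔.from ∋-pair (inj₁ refl))))
    ]′
    (comparable (pair a b) (⇔.from ∋-pair (inj₂ refl)) x∌b x∋a' ab∌a')
    where
      comparable = dominated-comparable dom

      a≢b' : a ≢ b'
      a≢b' = ∋∌⇒≢ x∋a x∌b'

      ab∌a' : ¬ pair a b ∋ a'
      ab∌a' = [ a'≢a , ∋∌⇒≢ x∋a' x∌b ]′ ∘ ⇔.to ∋-pair

      b'∉ab : ¬ (b' ≡ a ⊎ b' ≡ b)
      b'∉ab = [ a≢b' ∘ sym , b'≢b ]′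

      D∋b' : D ∋ b'
      D∋b' = Comparable-singleton⇒∋
        (comparable (singleton b') (⇔.from ∋-singleton refl) x∌b' x∋a (a≢b' ∘ ⇔.to ∋-singleton))

      D∌a : ¬ D ∋ a
      D∌a = Comparable-cosingleton⇒∌
        (comparable (cosingleton a) (⇔.from ∋-cosingleton (∋∌⇒≢ x∋a x∌b ∘ sym)) x∌b x∋a
                    (λ ca∋a → ⇔.to ∋-cosingleton ca∋a refl))

  dominated⇒singleton⊎cosingleton : ∀ {D x} → DominatesNonNeighbours D x →
    (∃ λ a → x ≈ singleton a) ⊎ (∃ λ a → x ≈ cosingleton a)
  dominated⇒singleton⊎cosingleton {D} {x} dom
    with em {∃ λ a → x ≈ singleton a} | em {∃ λ a → x ≈ cosingleton a}
  ... | yes isSingleton | _ = inj₁ isSingleton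
  ... | no _ | yes isCosingleton = inj₂ isCosingleton
  ... | no ¬singleton | no ¬cosingleton =
    let (a , x∋a) = ∃∋ x
        (b , x∌b) = ∃∌ x
        (a' , x∋a' , a'≢a) = ≉singleton⇒∃∋ x∋a (¬singleton ∘ (a ,_))
        (b' , x∌b' , b'≢b) = ≉cosingleton⇒∃∌ x∌b (¬cosingleton ∘ (b ,_))
    in ⊥-elim (¬dominates-two-in-two-out dom x∋a x∋a' a'≢a x∌b x∌b' b'≢b)

  ≡⇒≈ : ∀ {x y} → x ≡ y → x ≈ y
  ≡⇒≈ refl = ≈-refl

  ≈⊎Adj-respˡ : ∀ {x x' y} → x ≈ x' → (x ≈ y ⊎ Adj′ x y) ⇔ (x' ≈ y ⊎ Adj′ x' y)
  ≈⊎Adj-respˡ {y = y} x≈x' = mk⇔ (⊎-map (≈-trans (≈-sym x≈x')) (Adj-resp-≈ x≈x' (≈-refl {y})))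
                                 (⊎-map (≈-trans x≈x') (Adj-resp-≈ (≈-sym x≈x') (≈-refl {y})))

  singleton-¬Adj : ∀ {i k} → i ≢ k → ¬ Adj′ (singleton i) (singleton k)
  singleton-¬Adj i≢k = incomparable⇒¬Adj (⇔.from ∋-singleton refl) (i≢k ∘ ⇔.to ∋-singleton)
                                         (⇔.from ∋-singleton refl) (i≢k ∘ sym ∘ ⇔.to ∋-singleton)

  singleton≉cosingleton : ∀ {a c} → ¬ singleton a ≈ cosingleton c
  singleton≉cosingleton {a} {c} =
    let (d , d≢a , d≢c) = third a c
    in ∋∌⇒≉ (⇔.from ∋-cosingleton d≢c) (d≢a ∘ ⇔.to ∋-singleton) ∘ ≈-sym

  ¬Adj-singleton-cosingleton : ∀ {a c} → ¬ Adj′ (singleton a) (cosingleton c) → a ≡ c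
  ¬Adj-singleton-cosingleton {a} {c} ¬adj = dne λ a≢c →
    [ ¬adj , singleton≉cosingleton ]′ (swap (⊑⇒≈⊎Adj λ i sa∋i →
      ⇔.from ∋-cosingleton λ i≡c → a≢c (trans (sym (⇔.to ∋-singleton sa∋i)) i≡c)))

  Aut : Set₁
  Aut = Automorphism _∙_

  PreservesSingletons : Aut → Set
  PreservesSingletons f = ∀ i → ∃ λ j → Automorphism.to f (singleton i) ≈ singleton j

  module AutomorphismProperties (f : Aut) where
    open Automorphism f

    to-≈ : ∀ {x y} → x ≈ y → to x ≈ to y
    to-≈ (mk≈ x≐y) = mk≈ (to-cong x≐y)

    to-from-≈ : ∀ y → to (from y) ≈ y
    to-from-≈ y = mk≈ (to-from y)

    to-injective : ∀ {x y} → to x ≈ to y → x ≈ y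
    to-injective {x} {y} (mk≈ tx≐ty) =
      mk≈ (≐-trans (≐-sym (from-to x)) (≐-trans (from-cong tx≐ty) (from-to y)))

    to-≈⊎Adj⇔ : ∀ {x y} → (x ≈ y ⊎ Adj′ x y) ⇔ (to x ≈ to y ⊎ Adj′ (to x) (to y))
    to-≈⊎Adj⇔ = mk⇔ to-≈ to-injective ⊎-cong mk⇔ (adj-to _ _) (adj-from _ _)

    to-dominates : ∀ {D x} → DominatesNonNeighbours D x → DominatesNonNeighbours (to D) (to x)
    to-dominates {D} {x} dom E E≉tx ¬adj =
      ⊎-map (≈-trans (≈-sym tfE) ∘ to-≈) (Adj-resp-≈ (≈-refl {to D}) tfE ∘ adj-to D (from E))
            (dom (from E) (λ fE≈x → E≉tx (≈-trans (≈-sym tfE) (to-≈ fE≈x)))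
                          (λ adj → ¬adj (Adj-resp-≈ (≈-refl {to x}) tfE (adj-to x (from E) adj))))
      where tfE = to-from-≈ E

    to-singleton : ∀ i → (∃ λ j → to (singleton i) ≈ singleton j)
                       ⊎ (∃ λ j → to (singleton i) ≈ cosingleton j)
    to-singleton i = dominated⇒singleton⊎cosingleton (to-dominates (cosingleton-dominates i))

    images-¬Adj : ∀ {i k y z} → i ≢ k → to (singleton i) ≈ y → to (singleton k) ≈ z → ¬ Adj′ y z
    images-¬Adj i≢k ti tk = singleton-¬Adj i≢k ∘ adj-from _ _ ∘ Adj-resp-≈ (≈-sym ti) (≈-sym tk)

    -- Non-adjacency of the images forces a = c, and then the image of a third singleton
    -- coincides with one of the two given images.
    ¬mixed : ∀ {i k a c} → to (singleton i) ≈ singleton a → to (singleton k) ≈ cosingleton c → ⊥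
    ¬mixed {i} {k} {a} {c} ti tk with i ≟ k | third i k
    ... | yes refl | _ = singleton≉cosingleton (≈-trans (≈-sym ti) tk)
    ... | no i≢k | j , j≢i , j≢k = [ singletonImage , cosingletonImage ]′ (to-singleton j)
      where
        a≡c : a ≡ c
        a≡c = ¬Adj-singleton-cosingleton (images-¬Adj i≢k ti tk)

        sameImage : ∀ {j l y z} → to (singleton j) ≈ y → to (singleton l) ≈ z → y ≡ z → j ≡ l
        sameImage tj tl y≡z =
          singleton-injective (to-injective (≈-trans tj (≈-trans (≡⇒≈ y≡z) (≈-sym tl))))

        singletonImage : ¬ ∃ λ d → to (singleton j) ≈ singleton d
        singletonImage (d , tj) = j≢i (sameImage tj ti (cong singleton (trans d≡c (sym a≡c))))
          where d≡c = ¬Adj-singleton-cosingleton (images-¬Adj j≢k tj tk)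

        cosingletonImage : ¬ ∃ λ d → to (singleton j) ≈ cosingleton d
        cosingletonImage (d , tj) = j≢k (sameImage tj tk (cong cosingleton (trans (sym a≡d) a≡c)))
          where a≡d = ¬Adj-singleton-cosingleton (images-¬Adj (j≢i ∘ sym) ti tj)

    ¬preserves⇒swaps : ¬ PreservesSingletons f → ∀ i → ∃ λ j → to (singleton i) ≈ cosingleton j
    ¬preserves⇒swaps ¬preserves i with ¬∀⟶∃¬ n _ (λ _ → em) ¬preserves
    ... | k , ¬tk with to-singleton k | to-singleton i
    ... | inj₁ tk       | _             = ⊥-elim (¬tk tk)
    ... | inj₂ (c , tk) | inj₁ (a , ti) = ⊥-elim (¬mixed ti tk)
    ... | inj₂ _        | inj₂ ti       = ti

  Perm : Set
  Perm = Permutation′ n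

  ∃-reindex : ∀ (π : Perm) {P : Fin n → Set} → ∃ P → ∃ (P ∘ (π ⟨$⟩ˡ_))
  ∃-reindex π {P} (i , Pi) = π ⟨$⟩ʳ i , subst P (sym (inverseˡ π)) Pi

  ∃negateIf∋ : ∀ b x → ∃ λ i → negateIf b (x ∋ i)
  ∃negateIf∋ false = ∃∋
  ∃negateIf∋ true  = ∃∌

  ∃¬negateIf∋ : ∀ b x → ∃ λ i → ¬ negateIf b (x ∋ i)
  ∃¬negateIf∋ false   = ∃∌
  ∃¬negateIf∋ true  x = let (i , x∋i) = ∃∋ x in i , λ x∌i → x∌i x∋i

  act : Perm → Bool → V → V
  act π b x = union (λ k → negateIf b (x ∋ π ⟨$⟩ˡ k))
                    (∃-reindex π (∃negateIf∋ b x)) (∃-reindex π (∃¬negateIf∋ b x))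

  ∋-act : ∀ π b {x k} → act π b x ∋ k ⇔ negateIf b (x ∋ π ⟨$⟩ˡ k)
  ∋-act π b {x} = ∋-union (∃-reindex π (∃negateIf∋ b x)) (∃-reindex π (∃¬negateIf∋ b x))

  ∋-act-⟨$⟩ʳ : ∀ π b {x i} → act π b x ∋ π ⟨$⟩ʳ i ⇔ negateIf b (x ∋ i)
  ∋-act-⟨$⟩ʳ π b {x} {i} =
    subst (λ j → act π b x ∋ π ⟨$⟩ʳ i ⇔ negateIf b (x ∋ j)) (inverseˡ π) (∋-act π b)

  _⊑⟨_⟩_ : V → Bool → V → Set
  x ⊑⟨ b ⟩ y = ∀ i → negateIf b (x ∋ i) → negateIf b (y ∋ i)

  ⊑⟨true⟩⇔⊒ : ∀ {x y} → x ⊑⟨ true ⟩ y ⇔ y ⊑ x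
  ⊑⟨true⟩⇔⊒ = mk⇔ (λ x⊑y i y∋i → dne λ x∌i → x⊑y i x∌i y∋i) (λ y⊑x i x∌i y∋i → x∌i (y⊑x i y∋i))

  act-⊑⇔ : ∀ π b {x y} → x ⊑⟨ b ⟩ y ⇔ act π b x ⊑ act π b y
  act-⊑⇔ π b = mk⇔ (λ x⊑y k ax∋k → ⇔.from (∋-act π b) (x⊑y _ (⇔.to (∋-act π b) ax∋k)))
                   (λ ax⊑ay i x∋i → ⇔.to (∋-act-⟨$⟩ʳ π b) (ax⊑ay _ (⇔.from (∋-act-⟨$⟩ʳ π b) x∋i)))

  ⊏-cong : ∀ {x y x' y'} → x ⊑ y ⇔ x' ⊑ y' → y ⊑ x ⇔ y' ⊑ x' → x ⊏ y ⇔ x' ⊏ y'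
  ⊏-cong xy yx = mk⇔ (λ (p , q) → ⇔.to xy p , q ∘ ⇔.from yx) (λ (p , q) → ⇔.from xy p , q ∘ ⇔.to yx)

  -- For b = true the action reverses inclusions, which swaps the two cases of adjacency.
  act-Adj⇔ : ∀ π b {x y} → Adj′ x y ⇔ Adj′ (act π b x) (act π b y)
  act-Adj⇔ π false = ⇔-sym Adj⇔⊏⊎⊐ ⇔-∘ ((⊏-cong ⊑⇔ ⊑⇔ ⊎-cong ⊏-cong ⊑⇔ ⊑⇔) ⇔-∘ Adj⇔⊏⊎⊐)
    where ⊑⇔ = act-⊑⇔ π false
  act-Adj⇔ π true =
    mk⇔ swap swap ⇔-∘ (⇔-sym Adj⇔⊏⊎⊐ ⇔-∘ ((⊏-cong ⊒⇔ ⊒⇔ ⊎-cong ⊏-cong ⊒⇔ ⊒⇔) ⇔-∘ Adj⇔⊏⊎⊐))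
    where ⊒⇔ = λ {x y} → act-⊑⇔ π true {x} {y} ⇔-∘ ⇔-sym (⊑⟨true⟩⇔⊒ {x} {y})

  act-cong : ∀ π b {x y} → x ≈ y → act π b x ≈ act π b y
  act-cong π b x≈y = ∋-ext λ k →
    ⇔-sym (∋-act π b) ⇔-∘ (negateIf-cong b (mk⇔ (∋-resp-≈ x≈y) (∋-resp-≈ (≈-sym x≈y))) ⇔-∘ ∋-act π b)

  act-inverse : ∀ π ρ b → (∀ k → ρ ⟨$⟩ˡ (π ⟨$⟩ˡ k) ≡ k) → ∀ y → act π b (act ρ b y) ≈ y
  act-inverse π ρ b ρπ≗id y = ∋-ext λ k → begin
    act π b (act ρ b y) ∋ k                          ∼⟨ ∋-act π b ⟩
    negateIf b (act ρ b y ∋ π ⟨$⟩ˡ k)                ∼⟨ negateIf-cong b (∋-act ρ b) ⟩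
    negateIf b (negateIf b (y ∋ ρ ⟨$⟩ˡ (π ⟨$⟩ˡ k)))  ∼⟨ negateIf-involutive dne b ⟩
    y ∋ ρ ⟨$⟩ˡ (π ⟨$⟩ˡ k)                            ≡⟨ cong (y ∋_) (ρπ≗id k) ⟩
    y ∋ k                                            ∎
    where open EquationalReasoning {k = equivalence}

  actAutomorphism : Perm → Bool → Aut
  actAutomorphism π b = record
    { to        = act π b
    ; from      = act (flip π) b
    ; to-cong   = λ x≐y → ≈⇒≐ (act-cong π b (mk≈ x≐y))
    ; from-cong = λ x≐y → ≈⇒≐ (act-cong (flip π) b (mk≈ x≐y))
    ; to-from   = λ y → ≈⇒≐ (act-inverse π (flip π) b (λ _ → inverseʳ π) y)
    ; from-to   = λ x → ≈⇒≐ (act-inverse (flip π) π b (λ _ → inverseˡ π) x)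
    ; adj-to    = λ _ _ → ⇔.to (act-Adj⇔ π b)
    ; adj-from  = λ _ _ → ⇔.from (act-Adj⇔ π b)
    }

  record ActsAs (f : Aut) (π : Perm) (b : Bool) : Set₁ where
    constructor actsAs
    field ∋⇔ : ∀ x i → Automorphism.to f x ∋ π ⟨$⟩ʳ i ⇔ negateIf b (x ∋ i)
  open ActsAs

  actAutomorphism-actsAs : ∀ π b → ActsAs (actAutomorphism π b) π b
  actAutomorphism-actsAs π b = actsAs λ _ _ → ∋-act-⟨$⟩ʳ π b

  complement : Aut
  complement = actAutomorphism idₚ true

  marker : Bool → Fin n → V
  marker false = singleton
  marker true  = cosingleton

  ∋-marker : ∀ b {i k} → negateIf b (marker b i ∋ k) ⇔ k ≡ i
  ∋-marker false = ∋-singleton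
  ∋-marker true  = negateIf-involutive dne true ⇔-∘ negateIf-cong true ∋-cosingleton

  complement-cosingleton : ∀ a → act idₚ true (cosingleton a) ≈ singleton a
  complement-cosingleton a = ∋-ext λ k → ⇔-sym ∋-singleton ⇔-∘ (∋-marker true ⇔-∘ ∋-act idₚ true)

  module PreservingAutomorphism (f : Aut) (preserves : PreservesSingletons f) where
    open Automorphism f
    open AutomorphismProperties f

    σ : Fin n → Fin n
    σ i = proj₁ (preserves i)

    -- x ∋ i says that {i} equals or is adjacent to x, which the automorphism transports.
    to-∋-σ : ∀ x i → to x ∋ σ i ⇔ x ∋ i
    to-∋-σ x i = begin
      to x ∋ σ i                                                   ∼⟨ ∋⇔singleton-≈⊎Adj ⟩
      (singleton (σ i) ≈ to x ⊎ Adj′ (singleton (σ i)) (to x))     ∼⟨ ≈⊎Adj-respˡ (≈-sym (proj₂ (preserves i))) ⟩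
      (to (singleton i) ≈ to x ⊎ Adj′ (to (singleton i)) (to x))   ∼⟨ ⇔-sym to-≈⊎Adj⇔ ⟩
      (singleton i ≈ x ⊎ Adj′ (singleton i) x)                     ∼⟨ ⇔-sym ∋⇔singleton-≈⊎Adj ⟩
      x ∋ i                                                        ∎
      where open EquationalReasoning {k = equivalence}

    σ-injective : ∀ {i j} → σ i ≡ σ j → i ≡ j
    σ-injective {i} {j} σi≡σj = sym (⇔.to ∋-singleton (⇔.to (to-∋-σ (singleton i) j)
      (subst (to (singleton i) ∋_) σi≡σj (⇔.from (to-∋-σ (singleton i) i) (⇔.from ∋-singleton refl)))))

    σ-surjective : ∀ j → ∃ λ i → σ i ≡ j
    σ-surjective j = let (i , y∋i) = ∃∋ (from (singleton j)) in
      i , ⇔.to ∋-singleton (∋-resp-≈ (to-from-≈ (singleton j)) (⇔.from (to-∋-σ _ i) y∋i))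

    π : Perm
    π = permutation σ (proj₁ ∘ σ-surjective) (proj₂ ∘ σ-surjective)
                    (λ i → σ-injective (proj₂ (σ-surjective (σ i))))

    π-actsAs : ActsAs f π false
    π-actsAs = actsAs to-∋-σ

  complement∘-preserves : ∀ f → ¬ PreservesSingletons f → PreservesSingletons (_∘A_ _∙_ complement f)
  complement∘-preserves f ¬preserves i =
    let (j , ti) = AutomorphismProperties.¬preserves⇒swaps f ¬preserves i
    in j , ≈-trans (act-cong idₚ true ti) (complement-cosingleton j)

  complement∘-actsAs : ∀ {f π} → ActsAs (_∘A_ _∙_ complement f) π false → ActsAs f π true
  complement∘-actsAs acts = actsAs λ x i →
    negateIf-cong true (∋⇔ acts x i ⇔-∘ ⇔-sym (∋-act idₚ true)) ⇔-∘ ⇔-sym (negateIf-involutive dne true)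

  classify : ∀ f → Σ (SnZ2 n) λ t → ActsAs f (proj₁ t) (proj₂ t)
  classify f with em {PreservesSingletons f}
  ... | yes preserves = (π , false) , π-actsAs
    where open PreservingAutomorphism f preserves
  ... | no ¬preserves = (π , true) , complement∘-actsAs π-actsAs
    where open PreservingAutomorphism (_∘A_ _∙_ complement f) (complement∘-preserves f ¬preserves)

  actsAs-marker : ∀ {f π b i j} → ActsAs f π b → Automorphism.to f (marker b i) ∋ j ⇔ j ≡ π ⟨$⟩ʳ i
  actsAs-marker {f} {π} {b} {i} acts = mk⇔
    (λ y∋j → trans (sym (inverseʳ π)) (cong (π ⟨$⟩ʳ_)
      (⇔.to (∋-marker b) (⇔.to (∋⇔ acts _ _) (subst (y ∋_) (sym (inverseʳ π)) y∋j)))))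
    (λ { refl → ⇔.from (∋⇔ acts _ _) (⇔.from (∋-marker b) refl) })
    where y = Automorphism.to f (marker b i)

  -- Under a parity-0 action {0} goes to {π 0}, while a parity-1 action ρ puts ρ d into the
  -- image for every d ≠ 0; two such d contradict injectivity of ρ.
  ¬actsAs-both-parities : ∀ {f π ρ} → ActsAs f π false → ActsAs f ρ true → ⊥
  ¬actsAs-both-parities {π = π} {ρ} p q with fresh zero
  ... | d , d≢0 with third zero d
  ...   | d' , d'≢0 , d'≢d = d'≢d (begin
      d'                  ≡⟨ inverseˡ ρ ⟨
      ρ ⟨$⟩ˡ (ρ ⟨$⟩ʳ d')   ≡⟨ cong (ρ ⟨$⟩ˡ_) (trans (ρ-to-π0 d'≢0) (sym (ρ-to-π0 d≢0))) ⟩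
      ρ ⟨$⟩ˡ (ρ ⟨$⟩ʳ d)    ≡⟨ inverseˡ ρ ⟩
      d                   ∎)
    where
      open ≡-Reasoning
      ρ-to-π0 : ∀ {d} → d ≢ zero → ρ ⟨$⟩ʳ d ≡ π ⟨$⟩ʳ zero
      ρ-to-π0 d≢0 = ⇔.to (actsAs-marker {b = false} p) (⇔.from (∋⇔ q _ _) (d≢0 ∘ ⇔.to ∋-singleton))

  actsAs-same-parity : ∀ {f π ρ b} → ActsAs f π b → ActsAs f ρ b → ∀ i → π ⟨$⟩ʳ i ≡ ρ ⟨$⟩ʳ i
  actsAs-same-parity p q _ = sym (⇔.to (actsAs-marker p) (⇔.from (actsAs-marker q) refl))

  actsAs-unique : ∀ {f π ρ b c} → ActsAs f π b → ActsAs f ρ c → (π , b) ≈T (ρ , c)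
  actsAs-unique {b = false} {false} p q = actsAs-same-parity p q , refl
  actsAs-unique {b = true}  {true}  p q = actsAs-same-parity p q , refl
  actsAs-unique {b = false} {true}  p q = ⊥-elim (¬actsAs-both-parities p q)
  actsAs-unique {b = true}  {false} p q = ⊥-elim (¬actsAs-both-parities q p)

  actsAs-injective : ∀ {f g π ρ b} → ActsAs f π b → ActsAs g ρ b →
                     (∀ i → π ⟨$⟩ʳ i ≡ ρ ⟨$⟩ʳ i) → _≈A_ _∙_ f g
  actsAs-injective {f} {g} {π} {ρ} {b} p q π≗ρ x = ≈⇒≐ (∋-ext λ k → begin
    fx ∋ k                      ≡⟨ cong (fx ∋_) (inverseʳ π) ⟨
    fx ∋ π ⟨$⟩ʳ (π ⟨$⟩ˡ k)       ∼⟨ ∋⇔ p x _ ⟩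
    negateIf b (x ∋ π ⟨$⟩ˡ k)   ∼⟨ ⇔-sym (∋⇔ q x _) ⟩
    gx ∋ ρ ⟨$⟩ʳ (π ⟨$⟩ˡ k)       ≡⟨ cong (gx ∋_) (trans (sym (π≗ρ _)) (inverseʳ π)) ⟩
    gx ∋ k                      ∎)
    where
      open EquationalReasoning {k = equivalence}
      fx = Automorphism.to f x
      gx = Automorphism.to g x

  actsAs-resp-≈A : ∀ {f g π b} → _≈A_ _∙_ f g → ActsAs f π b → ActsAs g π b
  actsAs-resp-≈A f≈g acts = actsAs λ x i →
    ∋⇔ acts x i ⇔-∘ mk⇔ (∋-resp-≈ (≈-sym (mk≈ (f≈g x)))) (∋-resp-≈ (mk≈ (f≈g x)))

  actsAs-∘ : ∀ {f g π ρ b c} → ActsAs f π b → ActsAs g ρ c → ActsAs (_∘A_ _∙_ f g) (ρ ∘ₚ π) (b xor c)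
  actsAs-∘ {b = b} {c} p q = actsAs λ x i →
    negateIf-xor dne b c ⇔-∘ (negateIf-cong b (∋⇔ q x i) ⇔-∘ ∋⇔ p _ _)

  φ : Aut → SnZ2 n
  φ = proj₁ ∘ classify

  φ-actsAs : ∀ f → ActsAs f (proj₁ (φ f)) (proj₂ (φ f))
  φ-actsAs = proj₂ ∘ classify

  φ-isGroupIso : IsGroupIsoAut _∙_ φ
  φ-isGroupIso =
      (λ f g f≈g → actsAs-unique (actsAs-resp-≈A f≈g (φ-actsAs f)) (φ-actsAs g))
    , (λ f g → actsAs-unique (φ-actsAs (_∘A_ _∙_ f g)) (actsAs-∘ (φ-actsAs f) (φ-actsAs g)))
    , (λ f g (π≗ρ , b≡c) → actsAs-injective (φ-actsAs f) (subst (ActsAs g _) (sym b≡c) (φ-actsAs g)) π≗ρ)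
    , λ (π , b) → actAutomorphism π b , actsAs-unique (φ-actsAs _) (actAutomorphism-actsAs π b)

mainTheorem11 : ExcludedMiddle 0ℓ →
    (S : Set) (_∙_ : S → S → S) → IsSemigroup _≡_ _∙_ →
    IsCompletelySimple _∙_ →
    (n : ℕ) → 3 ≤ n → HasMinimalLeftIdeals _∙_ n →
    Σ (Automorphism _∙_ → SnZ2 n) (IsGroupIsoAut _∙_)
mainTheorem11 em S _∙_ isSemigroup (simple , _) _ (s≤s (s≤s (s≤s z≤n))) minimalLeftIdeals =
  φ , φ-isGroupIso
  where open InclusionIdealGraph em _∙_ (IsSemigroup.assoc isSemigroup) simple minimalLeftIdeals
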